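{- Let $m\ge 2$, and let $X$ and $f$ be the two-digit base-$m$ Kaprekar system. There exists $x\in X$ whose fixed set $K(x)$ is non-trivial and has cardinality $2$ if and only if $5\mid m+1$. Moreover, such a fixed set is unique: if $x,y\in X$ both have non-trivial fixed sets of cardinality $2$, then $K(x)=K(y)$.
   Context: $X=\{0,1,\dots,m^2-1\}$, each element written with exactly two base-$m$ digits $x=d_1m+d_0$ (leading zeros allowed). The map is $f(x)=\big(m\max(d_0,d_1)+\min(d_0,d_1)\big)-\big(m\min(d_0,d_1)+\max(d_0,d_1)\big)$. Iterates: $f^0=\mathrm{id}$ and $f^t=f\circ f^{t-1}$. For $x\in X$: $S(x)$ is the least $s\ge0$ such that $f^{s+t}(x)=f^s(x)$ for some $t\ge1$. $T(x)$ is the least $t\ge1$ with $f^{S(x)+t}(x)=f^{S(x)}(x)$. The fixed set is $K(x)=\{f^{S(x)+i}(x):0\le i<T(x)\}$. A fixed set is non-trivial if it is not $\{0\}$. -}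

module Defs where

open import Data.Nat using (ℕ; zero; suc; _+_; _*_; _∸_; _≤_; _<_; _⊔_; _⊓_; NonZero)
open import Data.Nat.DivMod using (_/_; _%_)
open import Data.Product using (Σ; ∃; _×_; _,_)
open import Data.Sum using (_⊎_)
open import Relation.Nullary using (¬_)
open import Relation.Binary.PropositionalEquality using (_≡_; _≢_)
open import Function.Bundles using (_⇔_)

-- Two base-m digits of x = d₁ m + d₀ (for x < m², d₁ = x / m, d₀ = x % m).
digit₁ : (m : ℕ) .{{_ : NonZero m}} → ℕ → ℕ
digit₁ m x = x / m

digit₀ : (m : ℕ) .{{_ : NonZero m}} → ℕ → ℕ
digit₀ m x = x % m

-- Kaprekar map: (m·max + min) − (m·min + max); the difference is ≥ 0,
-- so truncated subtraction is exact.
kap : (m : ℕ) .{{_ : NonZero m}} → ℕ → ℕ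
kap m x = (m * (d₀ ⊔ d₁) + (d₀ ⊓ d₁)) ∸ (m * (d₀ ⊓ d₁) + (d₀ ⊔ d₁))
  where
  d₀ = digit₀ m x
  d₁ = digit₁ m x

iter : (ℕ → ℕ) → ℕ → ℕ → ℕ
iter f zero    x = x
iter f (suc t) x = f (iter f t x)

Returns : (ℕ → ℕ) → ℕ → ℕ → Set
Returns f x s = ∃ λ t → 1 ≤ t × iter f (s + t) x ≡ iter f s x

IsS : (ℕ → ℕ) → ℕ → ℕ → Set
IsS f x s = Returns f x s × (∀ s′ → s′ < s → ¬ Returns f x s′)

IsT : (ℕ → ℕ) → ℕ → ℕ → ℕ → Set
IsT f x s t = 1 ≤ t × iter f (s + t) x ≡ iter f s x
            × (∀ t′ → 1 ≤ t′ → t′ < t → iter f (s + t′) x ≢ iter f s x)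

InK : (m : ℕ) .{{_ : NonZero m}} → ℕ → ℕ → Set
InK m x y = ∃ λ s → ∃ λ t → IsS (kap m) x s × IsT (kap m) x s t
          × ∃ λ i → i < t × y ≡ iter (kap m) (s + i) x

NonTrivialK : (m : ℕ) .{{_ : NonZero m}} → ℕ → Set
NonTrivialK m x = ¬ (∀ y → InK m x y ⇔ (y ≡ 0))

Card2K : (m : ℕ) .{{_ : NonZero m}} → ℕ → Set
Card2K m x = ∃ λ a → ∃ λ b → a ≢ b × (∀ y → InK m x y ⇔ (y ≡ a ⊎ y ≡ b))

-- Write m = p + 1. Since m·max + min − (m·min + max) = p·(max − min), the Kaprekar map sends x to
-- p·∣d₀ − d₁∣, so all its values are multiples p·c with c ≤ p; and for 1 ≤ c ≤ p the number p·c has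
-- digits c − 1 and m − c, so kap (p·c) = p·∣(m + 1) − 2c∣. A fixed set of size two is a 2-cycle of kap,
-- hence a 2-cycle of c ↦ ∣(m + 1) − 2c∣ on positive c, and the two absolute-value equations force
-- m + 1 = 5c and the cycle {c, 3c}. So such a fixed set must be {p·c, 3p·c} with 5c = m + 1, and
-- conversely that pair is a 2-cycle whenever 5 ∣ m + 1.
module Submission where

open import Defs
open import Data.Nat
  using (ℕ; zero; suc; _+_; _*_; _∸_; _≤_; _<_; _≤′_; ≤′-refl; ≤′-step; _⊔_; _⊓_; ∣_-_∣; NonZero; >-nonZero; z≤n; s≤s)
open import Data.Nat.Properties
open import Data.Nat.DivMod
  using (_%_; _/_; [m+kn]%n≡m%n; m<n⇒m%n≡m; m<n⇒m/n≡0; +-distrib-/-∣ʳ; m*n/n≡m; m%n<n; m<n*o⇒m/o<n)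
open import Data.Nat.Divisibility using (_∣_; divides; n∣m*n)
open import Data.Nat.Tactic.RingSolver using (solve)
open import Data.List using ([]; _∷_)
open import Data.Product using (∃; _×_; _,_)
open import Data.Sum using (_⊎_; inj₁; inj₂; swap; [_,_]′) renaming (map to ⊎-map)
open import Data.Empty using (⊥-elim)
open import Relation.Nullary using (¬_)
open import Relation.Binary using (tri<; tri≈; tri>)
open import Relation.Binary.PropositionalEquality
open import Function.Base using (_∘_; id)
open import Function.Bundles using (_⇔_; mk⇔; Equivalence)
import Function.Properties.Equivalence as ⇔

open Equivalence
open ≡-Reasoning

module _ (f : ℕ → ℕ) where

  iter-+ : ∀ a b x → iter f (a + b) x ≡ iter f a (iter f b x)
  iter-+ zero    b x = refl
  iter-+ (suc a) b x = cong f (iter-+ a b x)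

  iter-invariant : (P : ℕ → Set) → (∀ {y} → P y → P (f y)) → ∀ {x} → P x → ∀ n → P (iter f n x)
  iter-invariant P step Px zero    = Px
  iter-invariant P step Px (suc n) = step (iter-invariant P step Px n)

  iter-periodic : ∀ {x s t} → iter f (s + t) x ≡ iter f s x → ∀ n → iter f (n * t + s) x ≡ iter f s x
  iter-periodic r zero = refl
  iter-periodic {x} {s} {t} r (suc n) = begin
    iter f (t + n * t + s) x         ≡⟨ cong (λ k → iter f k x) (+-assoc t (n * t) s) ⟩
    iter f (t + (n * t + s)) x       ≡⟨ iter-+ t (n * t + s) x ⟩
    iter f t (iter f (n * t + s) x)  ≡⟨ cong (iter f t) (iter-periodic r n) ⟩
    iter f t (iter f s x)            ≡⟨ iter-+ t s x ⟨
    iter f (t + s) x                 ≡⟨ cong (λ k → iter f k x) (+-comm t s) ⟩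
    iter f (s + t) x                 ≡⟨ r ⟩
    iter f s x                       ∎

  iter-beyond-fixedPoint : ∀ {x a n L} → f a ≡ a → iter f n x ≡ a → n ≤ L → iter f L x ≡ a
  iter-beyond-fixedPoint {x} {a} {n} fa≡a fⁿx≡a n≤L = go (≤⇒≤′ n≤L)
    where
    go : ∀ {L} → n ≤′ L → iter f L x ≡ a
    go ≤′-refl        = fⁿx≡a
    go (≤′-step n≤′L) = trans (cong f (go n≤′L)) fa≡a

InFixedSet : (ℕ → ℕ) → ℕ → ℕ → Set
InFixedSet f x y = ∃ λ s → ∃ λ t → IsS f x s × IsT f x s t × ∃ λ i → i < t × y ≡ iter f (s + i) x

module _ (f : ℕ → ℕ) {x : ℕ} where

  IsS-unique : ∀ {s s′} → IsS f x s → IsS f x s′ → s ≡ s′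
  IsS-unique {s} {s′} (r , least) (r′ , least′) with <-cmp s s′
  ... | tri< s<s′ _ _ = ⊥-elim (least′ s s<s′ r)
  ... | tri≈ _ s≡s′ _ = s≡s′
  ... | tri> _ _ s′<s = ⊥-elim (least s′ s′<s r′)

  IsT-unique : ∀ {s t t′} → IsT f x s t → IsT f x s t′ → t ≡ t′
  IsT-unique {s} {t} {t′} (1≤t , r , least) (1≤t′ , r′ , least′) with <-cmp t t′
  ... | tri< t<t′ _ _ = ⊥-elim (least′ t 1≤t t<t′ r)
  ... | tri≈ _ t≡t′ _ = t≡t′
  ... | tri> _ _ t′<t = ⊥-elim (least t′ 1≤t′ t′<t r′)

  inFixedSet-⇔ : ∀ {s t} → IsS f x s → IsT f x s t →
                 ∀ y → InFixedSet f x y ⇔ (∃ λ i → i < t × y ≡ iter f (s + i) x)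
  inFixedSet-⇔ {s} {t} isS isT y = mk⇔ members (λ w → s , t , isS , isT , w)
    where
    members : InFixedSet f x y → ∃ λ i → i < t × y ≡ iter f (s + i) x
    members (s′ , t′ , isS′ , isT′ , w) with IsS-unique {s′} {s} isS′ isS
    ... | refl with IsT-unique {s} {t′} {t} isT′ isT
    ...   | refl = w

  inFixedSet-step : ∀ {a} → InFixedSet f x a → InFixedSet f x (f a)
  inFixedSet-step (s , t , isS , isT@(1≤t , r , _) , i , i<t , a≡) with m≤n⇒m<n∨m≡n i<t
  ... | inj₁ 1+i<t = s , t , isS , isT , suc i , 1+i<t ,
    trans (cong f a≡) (cong (λ k → iter f k x) (sym (+-suc s i)))
  ... | inj₂ 1+i≡t = s , t , isS , isT , 0 , 1≤t , (begin
    f _                      ≡⟨ cong f a≡ ⟩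
    iter f (suc (s + i)) x   ≡⟨ cong (λ k → iter f k x) (trans (sym (+-suc s i)) (cong (s +_) 1+i≡t)) ⟩
    iter f (s + t) x         ≡⟨ r ⟩
    iter f s x               ≡⟨ cong (λ k → iter f k x) (+-identityʳ s) ⟨
    iter f (s + 0) x         ∎)

  -- b recurs at every time j + (N t′ + s′), and from time N = s + i on the orbit sits at a.
  inFixedSet-fixedPoint : ∀ {a b} → InFixedSet f x a → InFixedSet f x b → f a ≡ a → a ≡ b
  inFixedSet-fixedPoint {a} {b} (s , _ , _ , _ , i , _ , a≡) (s′ , t′ , _ , (1≤t′ , r′ , _) , j , _ , b≡) fa≡a =
    begin
    a                                  ≡⟨ iter-beyond-fixedPoint f fa≡a (sym a≡) N≤L ⟨
    iter f (j + (N * t′ + s′)) x       ≡⟨ iter-+ f j (N * t′ + s′) x ⟩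
    iter f j (iter f (N * t′ + s′) x)  ≡⟨ cong (iter f j) (iter-periodic f r′ N) ⟩
    iter f j (iter f s′ x)             ≡⟨ iter-+ f j s′ x ⟨
    iter f (j + s′) x                  ≡⟨ cong (λ k → iter f k x) (+-comm j s′) ⟩
    iter f (s′ + j) x                  ≡⟨ b≡ ⟨
    b                                  ∎
    where
    N = s + i
    N≤L : N ≤ j + (N * t′ + s′)
    N≤L = ≤-trans (m≤m*n N t′ {{>-nonZero 1≤t′}}) (≤-trans (m≤m+n (N * t′) s′) (m≤n+m _ j))

  inFixedSet-invariant : (P : ℕ → Set) → (∀ {y} → P y → P (f y)) → P x → ∀ {y} → InFixedSet f x y → P y
  inFixedSet-invariant P step Px (s , _ , _ , _ , i , _ , y≡) =
    subst P (sym y≡) (iter-invariant f P step Px (s + i))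

  twoCycle-fixedSet : ∀ {y} → f x ≡ y → f y ≡ x → x ≢ y → ∀ z → InFixedSet f x z ⇔ (z ≡ x ⊎ z ≡ y)
  twoCycle-fixedSet {y} fx≡y fy≡x x≢y z = ⇔.trans (inFixedSet-⇔ isS isT z) (mk⇔ to′ from′)
    where
    returns : iter f 2 x ≡ x
    returns = trans (cong f fx≡y) fy≡x
    isS : IsS f x 0
    isS = (2 , s≤s z≤n , returns) , λ _ ()
    isT : IsT f x 0 2
    isT = s≤s z≤n , returns , λ where
      1 _ _ fx≡x → x≢y (trans (sym fx≡x) fx≡y)
      (suc (suc _)) _ (s≤s (s≤s ()))
    to′ : (∃ λ i → i < 2 × z ≡ iter f i x) → z ≡ x ⊎ z ≡ y
    to′ (0 , _ , z≡x) = inj₁ z≡x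
    to′ (1 , _ , z≡fx) = inj₂ (trans z≡fx fx≡y)
    to′ (suc (suc _) , s≤s (s≤s ()) , _)
    from′ : z ≡ x ⊎ z ≡ y → ∃ λ i → i < 2 × z ≡ iter f i x
    from′ (inj₁ z≡x) = 0 , s≤s z≤n , z≡x
    from′ (inj₂ z≡y) = 1 , s≤s (s≤s z≤n) , trans z≡y (sym fx≡y)

  pairFixedSet-step : ∀ {a b} → a ≢ b → (∀ z → InFixedSet f x z ⇔ (z ≡ a ⊎ z ≡ b)) → f a ≡ b
  pairFixedSet-step {a} {b} a≢b K≡ab =
    [ (λ fa≡a → ⊥-elim (a≢b (inFixedSet-fixedPoint a∈K b∈K fa≡a))) , id ]′
      (to (K≡ab (f a)) (inFixedSet-step a∈K))
    where
    a∈K = from (K≡ab a) (inj₁ refl)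
    b∈K = from (K≡ab b) (inj₂ refl)

pair≢singleton : ∀ {A : ℕ → Set} {a b c} → a ≢ b → (∀ z → A z ⇔ (z ≡ a ⊎ z ≡ b)) → ¬ (∀ z → A z ⇔ z ≡ c)
pair≢singleton a≢b A≡ab A≡c =
  a≢b (trans (to (A≡c _) (from (A≡ab _) (inj₁ refl))) (sym (to (A≡c _) (from (A≡ab _) (inj₂ refl)))))

unorderedPair-⇔ : ∀ {a b u v : ℕ} → (a ≡ u × b ≡ v) ⊎ (a ≡ v × b ≡ u) → ∀ z → (z ≡ a ⊎ z ≡ b) ⇔ (z ≡ u ⊎ z ≡ v)
unorderedPair-⇔ (inj₁ (refl , refl)) z = mk⇔ id id
unorderedPair-⇔ (inj₂ (refl , refl)) z = mk⇔ swap swap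

m≡n+∣m-n∣⊎n≡m+∣m-n∣ : ∀ m n → m ≡ n + ∣ m - n ∣ ⊎ n ≡ m + ∣ m - n ∣
m≡n+∣m-n∣⊎n≡m+∣m-n∣ zero    n       = inj₂ refl
m≡n+∣m-n∣⊎n≡m+∣m-n∣ (suc m) zero    = inj₁ refl
m≡n+∣m-n∣⊎n≡m+∣m-n∣ (suc m) (suc n) = ⊎-map (cong suc) (cong suc) (m≡n+∣m-n∣⊎n≡m+∣m-n∣ m n)

∣m-n∣≡d⇒m≡n+d⊎n≡m+d : ∀ {m n d} → ∣ m - n ∣ ≡ d → m ≡ n + d ⊎ n ≡ m + d
∣m-n∣≡d⇒m≡n+d⊎n≡m+d {m} {n} refl = m≡n+∣m-n∣⊎n≡m+∣m-n∣ m n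

m⊔n∸m⊓n≡∣m-n∣ : ∀ m n → m ⊔ n ∸ m ⊓ n ≡ ∣ m - n ∣
m⊔n∸m⊓n≡∣m-n∣ m n with ≤-total m n
... | inj₁ m≤n = trans (cong₂ _∸_ (m≤n⇒m⊔n≡n m≤n) (m≤n⇒m⊓n≡m m≤n)) (sym (m≤n⇒∣m-n∣≡n∸m m≤n))
... | inj₂ n≤m = trans (cong₂ _∸_ (m≥n⇒m⊔n≡m n≤m) (m≥n⇒m⊓n≡n n≤m)) (sym (m≤n⇒∣n-m∣≡n∸m n≤m))

n≡2c+c′⇒2c′≡n+c⇒n≡5c∧c′≡3c : ∀ {n c c′} → n ≡ 2 * c + c′ → 2 * c′ ≡ n + c → n ≡ 5 * c × c′ ≡ 3 * c
n≡2c+c′⇒2c′≡n+c⇒n≡5c∧c′≡3c {c = c} {c′} refl h = trans (cong (2 * c +_) c′≡3c) (solve (c ∷ [])) , c′≡3c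
  where
  c′≡3c : c′ ≡ 3 * c
  c′≡3c = +-cancelʳ-≡ c′ c′ (3 * c) (begin
    c′ + c′         ≡⟨ solve (c′ ∷ []) ⟩
    2 * c′          ≡⟨ h ⟩
    2 * c + c′ + c  ≡⟨ solve (c ∷ c′ ∷ []) ⟩
    3 * c + c′      ∎)

∣n-2c∣-twoCycle : ∀ n c c′ → ∣ n - 2 * c ∣ ≡ c′ → ∣ n - 2 * c′ ∣ ≡ c → c ≢ c′ →
                  (n ≡ 5 * c × c′ ≡ 3 * c) ⊎ (n ≡ 5 * c′ × c ≡ 3 * c′)
∣n-2c∣-twoCycle n c c′ e e′ c≢c′ with ∣m-n∣≡d⇒m≡n+d⊎n≡m+d e | ∣m-n∣≡d⇒m≡n+d⊎n≡m+d e′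
... | inj₁ n≡2c+c′ | inj₂ 2c′≡n+c = inj₁ (n≡2c+c′⇒2c′≡n+c⇒n≡5c∧c′≡3c n≡2c+c′ 2c′≡n+c)
... | inj₂ 2c≡n+c′ | inj₁ n≡2c′+c = inj₂ (n≡2c+c′⇒2c′≡n+c⇒n≡5c∧c′≡3c n≡2c′+c 2c≡n+c′)
... | inj₁ n≡2c+c′ | inj₁ n≡2c′+c = ⊥-elim (c≢c′ (+-cancelʳ-≡ (c + c′) c c′ (begin
  c + (c + c′)  ≡⟨ solve (c ∷ c′ ∷ []) ⟩
  2 * c + c′    ≡⟨ trans (sym n≡2c+c′) n≡2c′+c ⟩
  2 * c′ + c    ≡⟨ solve (c ∷ c′ ∷ []) ⟩
  c′ + (c + c′) ∎)))
... | inj₂ 2c≡n+c′ | inj₂ 2c′≡n+c = ⊥-elim (c≢c′ (*-cancelˡ-≡ c c′ 3 (+-cancelʳ-≡ n (3 * c) (3 * c′) (begin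
  3 * c + n            ≡⟨ solve (c ∷ n ∷ []) ⟩
  2 * c + (n + c)      ≡⟨ cong (_+ (n + c)) 2c≡n+c′ ⟩
  (n + c′) + (n + c)   ≡⟨ +-comm (n + c′) (n + c) ⟩
  (n + c) + (n + c′)   ≡⟨ cong (_+ (n + c′)) 2c′≡n+c ⟨
  2 * c′ + (n + c′)    ≡⟨ solve (c′ ∷ n ∷ []) ⟩
  3 * c′ + n           ∎))))

[1+p]*m+n∸[1+p]*n+m≡p*[m∸n] : ∀ p m n → (suc p * m + n) ∸ (suc p * n + m) ≡ p * (m ∸ n)
[1+p]*m+n∸[1+p]*n+m≡p*[m∸n] p m n = begin
  (suc p * m + n) ∸ (suc p * n + m)      ≡⟨ cong₂ _∸_ regroupˡ regroupʳ ⟩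
  ((m + n) + p * m) ∸ ((m + n) + p * n)  ≡⟨ [m+n]∸[m+o]≡n∸o (m + n) (p * m) (p * n) ⟩
  p * m ∸ p * n                          ≡⟨ *-distribˡ-∸ p m n ⟨
  p * (m ∸ n)                            ∎
  where
  regroupˡ : suc p * m + n ≡ (m + n) + p * m
  regroupˡ = solve (p ∷ m ∷ n ∷ [])
  regroupʳ : suc p * n + m ≡ (m + n) + p * n
  regroupʳ = solve (p ∷ m ∷ n ∷ [])

kap-formula : ∀ p x → kap (suc p) x ≡ p * ∣ x % suc p - x / suc p ∣
kap-formula p x =
  trans ([1+p]*m+n∸[1+p]*n+m≡p*[m∸n] p (d₀ ⊔ d₁) (d₀ ⊓ d₁)) (cong (p *_) (m⊔n∸m⊓n≡∣m-n∣ d₀ d₁))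
  where
  d₀ = x % suc p
  d₁ = x / suc p

kap-digits : ∀ p q r → r < suc p → kap (suc p) (r + q * suc p) ≡ p * ∣ r - q ∣
kap-digits p q r r<m = trans (kap-formula p (r + q * suc p)) (cong (p *_) (cong₂ ∣_-_∣ low high))
  where
  low : (r + q * suc p) % suc p ≡ r
  low = trans ([m+kn]%n≡m%n r q (suc p)) (m<n⇒m%n≡m r<m)
  high : (r + q * suc p) / suc p ≡ q
  high = trans (+-distrib-/-∣ʳ r (n∣m*n q)) (cong₂ _+_ (m<n⇒m/n≡0 r<m) (m*n/n≡m q (suc p)))

kap-zero : ∀ p → kap (suc p) 0 ≡ 0
kap-zero p = trans (kap-digits p 0 0 (s≤s z≤n)) (*-zeroʳ p)

kap-multiple : ∀ p c → 1 ≤ c → c ≤ p → kap (suc p) (p * c) ≡ p * ∣ 2 + p - 2 * c ∣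
kap-multiple p (suc d) _ 1+d≤p =
  subst (λ p → kap (suc p) (p * suc d) ≡ p * ∣ 2 + p - 2 * suc d ∣)
        (m+[n∸m]≡n (≤-trans (n≤1+n d) 1+d≤p)) (kap-multiple′ (p ∸ d))
  where
  kap-multiple′ : ∀ r → kap (suc (d + r)) ((d + r) * suc d) ≡ (d + r) * ∣ 2 + (d + r) - 2 * suc d ∣
  kap-multiple′ r = begin
    kap (suc (d + r)) ((d + r) * suc d)      ≡⟨ cong (kap (suc (d + r))) p[1+d]≡r+d[1+p] ⟩
    kap (suc (d + r)) (r + d * suc (d + r))  ≡⟨ kap-digits (d + r) d r (s≤s (m≤n+m r d)) ⟩
    (d + r) * ∣ r - d ∣                      ≡⟨ cong ((d + r) *_) (∣m+n-m+o∣≡∣n-o∣ (2 + d) r d) ⟨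
    (d + r) * ∣ 2 + d + r - 2 + d + d ∣      ≡⟨ cong (λ k → (d + r) * ∣ 2 + (d + r) - k ∣) 2+d+d≡2[1+d] ⟩
    (d + r) * ∣ 2 + (d + r) - 2 * suc d ∣    ∎
    where
    p[1+d]≡r+d[1+p] : (d + r) * suc d ≡ r + d * suc (d + r)
    p[1+d]≡r+d[1+p] = solve (d ∷ r ∷ [])
    2+d+d≡2[1+d] : 2 + d + d ≡ 2 * suc d
    2+d+d≡2[1+d] = solve (d ∷ [])

kap-image : ∀ p x → x < suc p * suc p → ∃ λ c → c ≤ p × kap (suc p) x ≡ p * c
kap-image p x x<m² =
  ∣ x % suc p - x / suc p ∣ ,
  ≤-trans (∣m-n∣≤m⊔n (x % suc p) (x / suc p))
          (⊔-lub (≤-pred (m%n<n x (suc p))) (≤-pred (m<n*o⇒m/o<n x<m²))) ,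
  kap-formula p x

multiple<square : ∀ p c → c ≤ p → p * c < suc p * suc p
multiple<square p c c≤p = ≤-<-trans (*-monoʳ-≤ p c≤p) (*-mono-< (n<1+n p) (n<1+n p))

kap-range : ∀ p {x} → x < suc p * suc p → kap (suc p) x < suc p * suc p
kap-range p {x} x<m² with c , c≤p , kx≡pc ← kap-image p x x<m² =
  subst (_< suc p * suc p) (sym kx≡pc) (multiple<square p c c≤p)

kap-multiple-distance : ∀ p .{{_ : NonZero p}} c c′ → c ≤ p →
                        kap (suc p) (p * c) ≡ p * c′ → p * c′ ≢ p * c → ∣ 2 + p - 2 * c ∣ ≡ c′
kap-multiple-distance p zero c′ _ kp0≡pc′ moved = ⊥-elim (moved (begin
  p * c′               ≡⟨ kp0≡pc′ ⟨
  kap (suc p) (p * 0)  ≡⟨ cong (kap (suc p)) p0≡0 ⟩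
  kap (suc p) 0        ≡⟨ kap-zero p ⟩
  0                    ≡⟨ p0≡0 ⟨
  p * 0                ∎))
  where p0≡0 = *-zeroʳ p
kap-multiple-distance p c@(suc _) c′ c≤p kpc≡pc′ _ =
  *-cancelˡ-≡ _ c′ p (trans (sym (kap-multiple p c (s≤s z≤n) c≤p)) kpc≡pc′)

kap-twoCycle : ∀ p .{{_ : NonZero p}} {a b} → a < suc p * suc p → b < suc p * suc p →
               kap (suc p) a ≡ b → kap (suc p) b ≡ a → a ≢ b →
               ∃ λ c → 2 + p ≡ 5 * c × ((a ≡ p * c × b ≡ p * (3 * c)) ⊎ (a ≡ p * (3 * c) × b ≡ p * c))
kap-twoCycle p {a} {b} a<m² b<m² ka≡b kb≡a a≢b
  with c , c≤p , kb≡pc ← kap-image p b b<m²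
     | c′ , c′≤p , ka≡pc′ ← kap-image p a a<m²
  with refl ← trans (sym kb≡a) kb≡pc
  with refl ← trans (sym ka≡b) ka≡pc′
  with ∣n-2c∣-twoCycle (2 + p) c c′ (kap-multiple-distance p c c′ c≤p ka≡b (a≢b ∘ sym))
                                    (kap-multiple-distance p c′ c c′≤p kb≡a a≢b) (a≢b ∘ cong (p *_))
... | inj₁ (n≡5c , refl) = c , n≡5c , inj₁ (refl , refl)
... | inj₂ (n≡5c′ , refl) = c′ , n≡5c′ , inj₂ (refl , refl)

card2-fixedSet : ∀ p .{{_ : NonZero p}} {x} → x < suc p * suc p → Card2K (suc p) x →
                 ∃ λ c → 2 + p ≡ 5 * c × (∀ z → InK (suc p) x z ⇔ (z ≡ p * c ⊎ z ≡ p * (3 * c)))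
card2-fixedSet p {x} x<m² (a , b , a≢b , K≡ab) =
  let c , n≡5c , ab≡ = kap-twoCycle p (below-square a∈K) (below-square b∈K) ka≡b kb≡a a≢b
  in c , n≡5c , λ z → ⇔.trans (K≡ab z) (unorderedPair-⇔ ab≡ z)
  where
  f = kap (suc p)
  a∈K = from (K≡ab a) (inj₁ refl)
  b∈K = from (K≡ab b) (inj₂ refl)
  below-square : ∀ {y} → InK (suc p) x y → y < suc p * suc p
  below-square = inFixedSet-invariant f (_< suc p * suc p) (kap-range p) x<m²
  ka≡b = pairFixedSet-step f a≢b K≡ab
  kb≡a = pairFixedSet-step f (a≢b ∘ sym) (λ z → ⇔.trans (K≡ab z) (mk⇔ swap swap))

card2-fixedSets-equal : ∀ p .{{_ : NonZero p}} {x y} → x < suc p * suc p → y < suc p * suc p →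
                        Card2K (suc p) x → Card2K (suc p) y → ∀ z → InK (suc p) x z ⇔ InK (suc p) y z
card2-fixedSets-equal p {y = y} x<m² y<m² card2ˣ card2ʸ z =
  let c , n≡5c , Kx = card2-fixedSet p x<m² card2ˣ
      c′ , n≡5c′ , Ky = card2-fixedSet p y<m² card2ʸ
      c′≡c = *-cancelˡ-≡ c′ c 5 (trans (sym n≡5c′) n≡5c)
  in ⇔.trans (Kx z) (subst (λ k → (z ≡ p * k ⊎ z ≡ p * (3 * k)) ⇔ InK (suc p) y z) c′≡c (⇔.sym (Ky z)))

card2-exists : ∀ p .{{_ : NonZero p}} c → 2 + p ≡ 5 * c →
               ∃ λ x → x < suc p * suc p × NonTrivialK (suc p) x × Card2K (suc p) x
card2-exists p zero ()
card2-exists p c@(suc _) n≡5c =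
  p * c , multiple<square p c c≤p , pair≢singleton {A = InK (suc p) (p * c)} x≢y K≡xy ,
  p * c , p * (3 * c) , x≢y , K≡xy
  where
  1≤c : 1 ≤ c
  1≤c = s≤s z≤n
  2+3c≤2+p : 2 + 3 * c ≤ 2 + p
  2+3c≤2+p = ≤-trans (+-monoˡ-≤ (3 * c) (*-monoʳ-≤ 2 1≤c)) (≤-reflexive (trans (2c+3c≡5c c) (sym n≡5c)))
    where
    2c+3c≡5c : ∀ c → 2 * c + 3 * c ≡ 5 * c
    2c+3c≡5c c = solve (c ∷ [])
  3c≤p : 3 * c ≤ p
  3c≤p = +-cancelˡ-≤ 2 (3 * c) p 2+3c≤2+p
  c≤p : c ≤ p
  c≤p = ≤-trans (m≤m+n c (2 * c)) 3c≤p
  kx≡y : kap (suc p) (p * c) ≡ p * (3 * c)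
  kx≡y = trans (kap-multiple p c 1≤c c≤p) (cong (p *_) (begin
    ∣ 2 + p - 2 * c ∣               ≡⟨ cong (λ n → ∣ n - 2 * c ∣) (trans n≡5c (5c≡2c+3c c)) ⟩
    ∣ 2 * c + 3 * c - 2 * c ∣        ≡⟨ ∣-∣-comm (2 * c + 3 * c) (2 * c) ⟩
    ∣ 2 * c - 2 * c + 3 * c ∣        ≡⟨ ∣m-m+n∣≡n (2 * c) (3 * c) ⟩
    3 * c                           ∎))
    where
    5c≡2c+3c : ∀ c → 5 * c ≡ 2 * c + 3 * c
    5c≡2c+3c c = solve (c ∷ [])
  ky≡x : kap (suc p) (p * (3 * c)) ≡ p * c
  ky≡x = trans (kap-multiple p (3 * c) (≤-trans 1≤c (m≤m+n c (2 * c))) 3c≤p) (cong (p *_) (begin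
    ∣ 2 + p - 2 * (3 * c) ∣          ≡⟨ cong₂ ∣_-_∣ n≡5c (6c≡5c+c c) ⟩
    ∣ 5 * c - 5 * c + c ∣            ≡⟨ ∣m-m+n∣≡n (5 * c) c ⟩
    c                               ∎))
    where
    6c≡5c+c : ∀ c → 2 * (3 * c) ≡ 5 * c + c
    6c≡5c+c c = solve (c ∷ [])
  x≢y : p * c ≢ p * (3 * c)
  x≢y pc≡3pc = <⇒≢ (m<m+n c (≤-trans 1≤c (m≤m+n c (1 * c)))) (*-cancelˡ-≡ c (3 * c) p pc≡3pc)
  K≡xy : ∀ z → InK (suc p) (p * c) z ⇔ (z ≡ p * c ⊎ z ≡ p * (3 * c))
  K≡xy = twoCycle-fixedSet (kap (suc p)) kx≡y ky≡x x≢y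

lemma3p3p4 : (m : ℕ) .{{_ : NonZero m}} → 2 ≤ m →
    ((∃ λ x → x < m * m × NonTrivialK m x × Card2K m x) ⇔ (5 ∣ m + 1))
    × (∀ x y → x < m * m → y < m * m →
        NonTrivialK m x → Card2K m x →
        NonTrivialK m y → Card2K m y →
        ∀ z → InK m x z ⇔ InK m y z)
lemma3p3p4 (suc zero) (s≤s ())
lemma3p3p4 (suc (suc q)) _ =
  -- A two-element fixed set is never {0}.
  mk⇔ existence⇒5∣m+1 5∣m+1⇒existence ,
  λ x y x<m² y<m² _ card2ˣ _ card2ʸ → card2-fixedSets-equal p {x} {y} x<m² y<m² card2ˣ card2ʸ
  where
  p = suc q
  m+1≡2+p : suc p + 1 ≡ 2 + p
  m+1≡2+p = +-comm (suc p) 1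
  existence⇒5∣m+1 : (∃ λ x → x < suc p * suc p × NonTrivialK (suc p) x × Card2K (suc p) x) → 5 ∣ suc p + 1
  existence⇒5∣m+1 (x , x<m² , _ , card2) =
    let c , n≡5c , _ = card2-fixedSet p x<m² card2 in divides c (trans m+1≡2+p (trans n≡5c (*-comm 5 c)))
  5∣m+1⇒existence : 5 ∣ suc p + 1 → ∃ λ x → x < suc p * suc p × NonTrivialK (suc p) x × Card2K (suc p) x
  5∣m+1⇒existence (divides c m+1≡c*5) = card2-exists p c (trans (sym m+1≡2+p) (trans m+1≡c*5 (*-comm c 5)))
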